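{- Let $t \ge 1$ be an integer and $T$ a strongly connected $t$-arc-bounded tournament. Suppose $T$ has a dominating set $\gamma^+$ and an absorbing set $\gamma^-$. Then $\vec\chi(T) \le 5t \cdot |\gamma^-| \cdot |\gamma^+|$.
   Context: A dominating set is a set $S \subseteq V(T)$ such that every vertex not in $S$ has an in-neighbour in $S$; an absorbing set is a set $S$ such that every vertex not in $S$ has an out-neighbour in $S$. For an arc $e=uv$, $N(e) = N^+(v)\cap N^-(u)$. $\vec\chi$ of a tournament is the minimum number of acyclic induced subtournaments partitioning its vertex set. $T$ is $t$-arc-bounded if $\vec\chi(T[N(e)]) \le t$ for every arc $e$. -}

module Defs where

open import Data.Nat using (ℕ)
open import Data.Fin using (Fin)
open import Data.Fin.Subset using (Subset; _∈_; _∉_)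
open import Data.Product using (Σ; ∃; _×_; _,_)
open import Data.Sum using (_⊎_)
open import Relation.Nullary using (¬_)
open import Relation.Binary.PropositionalEquality using (_≡_; _≢_)
open import Relation.Binary using (Decidable)
open import Relation.Unary using (Pred)
open import Level using (0ℓ)
open import Data.Unit using (⊤)

record Tournament (n : ℕ) : Set₁ where
  field
    arc     : Fin n → Fin n → Set
    arc?    : Decidable arc
    irrefl  : ∀ u → ¬ arc u u
    asym    : ∀ u v → arc u v → ¬ arc v u
    total   : ∀ u v → u ≢ v → arc u v ⊎ arc v u

module _ {n : ℕ} (T : Tournament n) where
  open Tournament T

  data PathIn (A : Pred (Fin n) 0ℓ) : Fin n → Fin n → Set where
    here : ∀ {x} → A x → PathIn A x x
    step : ∀ {x y z} → A x → arc x y → PathIn A y z → PathIn A x z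

  data Path : Fin n → Fin n → Set where
    here : ∀ {x} → Path x x
    step : ∀ {x y z} → arc x y → Path y z → Path x z

  StronglyConnected : Set
  StronglyConnected = ∀ u v → Path u v

  Acyclic : Pred (Fin n) 0ℓ → Set
  Acyclic A = ∀ u v → A u → A v → arc u v → ¬ PathIn A v u

  DichromaticAtMost : Pred (Fin n) 0ℓ → ℕ → Set
  DichromaticAtMost A k =
    Σ (Fin n → Fin k) λ c → ∀ i → Acyclic (λ w → A w × c w ≡ i)

  N : Fin n → Fin n → Pred (Fin n) 0ℓ
  N u v w = arc v w × arc w u

  ArcBounded : ℕ → Set
  ArcBounded t = ∀ u v → arc u v → DichromaticAtMost (N u v) t

  Dominating : Subset n → Set
  Dominating S = ∀ v → v ∉ S → Σ (Fin n) λ u → u ∈ S × arc u v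

  Absorbing : Subset n → Set
  Absorbing S = ∀ v → v ∉ S → Σ (Fin n) λ u → u ∈ S × arc v u

  Whole : Pred (Fin n) 0ℓ
  Whole _ = ⊤

{-# OPTIONS --safe #-}
-- For b ∈ γ⁻ and d ∈ γ⁺ fix a shortest path b = p_k → ⋯ → p₀ = d, indexed
-- backwards from d. A vertex v with v ⇒ b and d ⇒ v (where x ⇒ y means x → y or
-- x = y) lies in N(p_{j+1} p_j) for an index j < k at which "v ⇒ p_j" switches
-- from false to true. Colour v by b, d, j mod 5 and its colour in a t-colouring
-- of N(p_{j+1} p_j). Distances from b grow by at most one along arcs and v is
-- within two steps of p_j, so an arc x → y inside one colour class has
-- j(x) ≤ j(y) + 4, hence j(x) ≤ j(y): a cycle stays in a single colour class of
-- a single N(p_{j+1} p_j), which is acyclic. When b = d the class is just {b}.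
module Submission where

open import Defs
open import Data.Nat using (ℕ; zero; suc; _*_; _+_; _≤_; _<_; z≤n; s≤s; _%_; _/_; NonZero)
open import Data.Nat.Properties
open import Data.Nat.DivMod using (m≡m%n+[m/n]*n; _mod_)
open import Algebra.Properties.CommutativeSemigroup +-commutativeSemigroup using (x∙yz≈y∙xz)
open import Data.Fin using (Fin; zero; suc; toℕ; combine)
open import Data.Fin.Properties using (any?; combine-injective; toℕ-fromℕ<)
  renaming (_≟_ to _≟ᶠ_; suc-injective to Fin-suc-injective)
open import Data.Fin.Subset using (Subset; ∣_∣; _∈_; inside; outside)
open import Data.Fin.Subset.Properties using (_∈?_)
open import Data.Vec.Base using (_∷_; here; there)
open import Data.Product using (∃; _×_; _,_; proj₁; proj₂)
open import Data.Sum using (_⊎_; inj₁; inj₂)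
open import Data.Empty using (⊥-elim)
open import Level using (0ℓ)
open import Function using (_∘_)
open import Relation.Nullary using (¬_; Dec; yes; no; contradiction)
open import Relation.Nullary.Decidable using (_×-dec_; _⊎-dec_)
open import Relation.Unary as U using (Pred)
open import Relation.Binary using (Decidable)
open import Relation.Binary.Construct.Closure.Reflexive using (ReflClosure; refl; [_])
open import Relation.Binary.PropositionalEquality
  using (_≡_; _≢_; refl; sym; trans; cong; subst; subst₂)

module _ {p} {P : Pred ℕ p} (P? : U.Decidable P) where

  least : ∃ P → ∃ λ m → P m × (∀ {j} → P j → m ≤ j)
  least (k , pk) = below k (k , ≤-refl , pk)
    where
    below : ∀ k → (∃ λ j → j ≤ k × P j) → ∃ λ m → P m × (∀ {j} → P j → m ≤ j)
    below zero    (_ , z≤n , p0) = 0 , p0 , λ _ → z≤n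
    below (suc k) (j , j≤1+k , pj) with anyUpTo? P? (suc k)
    ... | yes (i , s≤s i≤k , pi) = below k (i , i≤k , pi)
    ... | no  nothing-below      =
      j , pj , λ {i} pi → ≮⇒≥ λ i<j → nothing-below (i , <-≤-trans i<j j≤1+k , pi)

  crossing : ∀ {a k} → a ≤ k → ¬ P a → P k → ∃ λ j → j < k × ¬ P j × P (suc j)
  crossing {k = zero}  z≤n ¬pa pk = contradiction pk ¬pa
  crossing {k = suc k} a≤1+k ¬pa pk with P? k | m≤n⇒m<n∨m≡n a≤1+k
  ... | no ¬pk | _            = k , ≤-refl , ¬pk , pk
  ... | yes _  | inj₂ refl    = contradiction pk ¬pa
  ... | yes pk′ | inj₁ a<1+k with crossing (<⇒≤pred a<1+k) ¬pa pk′
  ...   | j , j<k , ¬pj , p1+j = j , m<n⇒m<1+n j<k , ¬pj , p1+j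

%-≡⇒≤ : ∀ m .{{_ : NonZero m}} {a b} → a % m ≡ b % m → a < m + b → a ≤ b
%-≡⇒≤ m {a} {b} a≡b a<m+b = begin
  a                   ≡⟨ m≡m%n+[m/n]*n a m ⟩
  a % m + a / m * m   ≤⟨ +-monoʳ-≤ (a % m) (*-monoˡ-≤ m (<⇒≤pred quotient<)) ⟩
  a % m + b / m * m   ≡⟨ cong (_+ b / m * m) a≡b ⟩
  b % m + b / m * m   ≡⟨ m≡m%n+[m/n]*n b m ⟨
  b                   ∎
  where
  open ≤-Reasoning
  quotient< : a / m < suc (b / m)
  quotient< = *-cancelʳ-< m (a / m) (suc (b / m)) (+-cancelˡ-< (a % m) _ _ (begin-strict
    a % m + a / m * m         ≡⟨ m≡m%n+[m/n]*n a m ⟨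
    a                         <⟨ a<m+b ⟩
    m + b                     ≡⟨ cong (m +_) (m≡m%n+[m/n]*n b m) ⟩
    m + (b % m + b / m * m)   ≡⟨ x∙yz≈y∙xz m (b % m) (b / m * m) ⟩
    b % m + (m + b / m * m)   ≡⟨ cong (_+ (m + b / m * m)) a≡b ⟨
    a % m + suc (b / m) * m   ∎))

mod≡⇒%≡ : ∀ m .{{_ : NonZero m}} a b → a mod m ≡ b mod m → a % m ≡ b % m
mod≡⇒%≡ m a b a≡b = trans (sym (toℕ-fromℕ< _)) (trans (cong toℕ a≡b) (toℕ-fromℕ< _))

position : ∀ {m} (p : Subset m) {x} → x ∈ p → Fin ∣ p ∣
position (inside  ∷ p) here        = zero
position (inside  ∷ p) (there x∈p) = suc (position p x∈p)
position (outside ∷ p) (there x∈p) = position p x∈p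

position-injective : ∀ {m} (p : Subset m) {x y} (x∈p : x ∈ p) (y∈p : y ∈ p) →
                     position p x∈p ≡ position p y∈p → x ≡ y
position-injective (inside  ∷ p) here        here        _  = refl
position-injective (inside  ∷ p) (there x∈p) (there y∈p) eq =
  cong suc (position-injective p x∈p y∈p (Fin-suc-injective eq))
position-injective (outside ∷ p) (there x∈p) (there y∈p) eq =
  cong suc (position-injective p x∈p y∈p eq)

module _ {n : ℕ} (T : Tournament n) where
  open Tournament T

  reflClosure? : Decidable (ReflClosure arc)
  reflClosure? x y with x ≟ᶠ y | arc? x y
  ... | yes refl | _     = yes refl
  ... | no  _    | yes a = yes [ a ]
  ... | no  x≢y  | no ¬a = no λ { refl → x≢y refl ; [ a ] → ¬a a }

  reflClosure-antisym : ∀ {x y} → ReflClosure arc x y → ReflClosure arc y x → x ≡ y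
  reflClosure-antisym refl  _      = refl
  reflClosure-antisym [ _ ] refl   = refl
  reflClosure-antisym [ a ] [ a′ ] = ⊥-elim (asym _ _ a a′)

  arc⇒¬reflClosure : ∀ {x y} → arc x y → ¬ ReflClosure arc y x
  arc⇒¬reflClosure x→x refl    = irrefl _ x→x
  arc⇒¬reflClosure x→y [ y→x ] = asym _ _ x→y y→x

  ¬reflClosure⇒arc : ∀ {x y} → ¬ ReflClosure arc x y → arc y x
  ¬reflClosure⇒arc {x} {y} x⇏y with total y x (λ { refl → x⇏y refl })
  ... | inj₁ y→x = y→x
  ... | inj₂ x→y = contradiction [ x→y ] x⇏y

  reflClosure⇒arc : ∀ {x y z} → ReflClosure arc x y → ¬ ReflClosure arc x z → arc y z → arc x y
  reflClosure⇒arc refl    x⇏z y→z = contradiction [ y→z ] x⇏z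
  reflClosure⇒arc [ x→y ] _   _   = x→y

  PathIn-map : ∀ {A B : Pred (Fin n) 0ℓ} → (∀ {w} → A w → B w) →
               ∀ {x y} → PathIn T A x y → PathIn T B x y
  PathIn-map f (here a)       = here (f a)
  PathIn-map f (step a x→y p) = step (f a) x→y (PathIn-map f p)

  PathIn-source : ∀ {A x y} → PathIn T A x y → A x
  PathIn-source (here a)     = a
  PathIn-source (step a _ _) = a

  Acyclic-mono : ∀ {A B : Pred (Fin n) 0ℓ} → (∀ {w} → A w → B w) → Acyclic T B → Acyclic T A
  Acyclic-mono A⊆B acyclic u v au av u→v = acyclic u v (A⊆B au) (A⊆B av) u→v ∘ PathIn-map A⊆B

  module Levels (A : Pred (Fin n) 0ℓ) (ι : Fin n → ℕ)
                (ι-mono : ∀ {x y} → A x → A y → arc x y → ι x ≤ ι y) where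

    Level : ℕ → Pred (Fin n) 0ℓ
    Level j w = A w × ι w ≡ j

    PathIn-mono : ∀ {x y} → PathIn T A x y → ι x ≤ ι y
    PathIn-mono (here _)        = ≤-refl
    PathIn-mono (step ax x→y p) = ≤-trans (ι-mono ax (PathIn-source p) x→y) (PathIn-mono p)

    PathIn-level : ∀ {x y} → PathIn T A x y → ι y ≤ ι x → PathIn T (Level (ι y)) x y
    PathIn-level (here ax) _ = here (ax , refl)
    PathIn-level p@(step ax x→y q) ιy≤ιx =
      step (ax , ≤-antisym (PathIn-mono p) ιy≤ιx) x→y
           (PathIn-level q (≤-trans ιy≤ιx (ι-mono ax (PathIn-source q) x→y)))

    Acyclic-byLevels : (∀ {w} → A w → Acyclic T (Level (ι w))) → Acyclic T A
    Acyclic-byLevels level-acyclic u v au av u→v v⇝u =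
      level-acyclic au u v (au , refl) (av , ≤-antisym (PathIn-mono v⇝u) ιu≤ιv) u→v
        (PathIn-level v⇝u ιu≤ιv)
      where ιu≤ιv = ι-mono au av u→v

  module ArcColouring {t} (AB : ArcBounded T t) (c₀ : Fin t) where

    arcColouring : Fin n → Fin n → Fin n → Fin t
    arcColouring u w with arc? u w
    ... | yes u→w = proj₁ (AB u w u→w)
    ... | no  _   = λ _ → c₀

    arcColouring-acyclic : ∀ {u w} → arc u w → ∀ c →
                           Acyclic T (λ z → N T u w z × arcColouring u w z ≡ c)
    arcColouring-acyclic {u} {w} u→w c with arc? u w
    ... | yes u→w′ = proj₂ (AB u w u→w′) c
    ... | no  ¬u→w = contradiction u→w ¬u→w

  module Distance (SC : StronglyConnected T) (b : Fin n) where

    Within : ℕ → Pred (Fin n) 0ℓ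
    Within zero    x = x ≡ b
    Within (suc m) x = Within m x ⊎ ∃ λ y → Within m y × arc y x

    within? : ∀ m → U.Decidable (Within m)
    within? zero    x = x ≟ᶠ b
    within? (suc m) x = within? m x ⊎-dec any? (λ y → within? m y ×-dec arc? y x)

    within-path : ∀ {m y x} → Within m y → Path T y x → ∃ λ m′ → Within m′ x
    within-path w here            = _ , w
    within-path w (step y→z z⇝x) = within-path (inj₂ (_ , w , y→z)) z⇝x

    shortest : ∀ x → ∃ λ m → Within m x × (∀ {j} → Within j x → m ≤ j)
    shortest x = least (λ m → within? m x) (within-path {0} refl (SC b x))

    dist : Fin n → ℕ
    dist x = proj₁ (shortest x)

    dist-within : ∀ x → Within (dist x) x
    dist-within x = proj₁ (proj₂ (shortest x))

    dist-minimal : ∀ {x j} → Within j x → dist x ≤ j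
    dist-minimal {x} = proj₂ (proj₂ (shortest x))

    dist-arc : ∀ {x y} → arc x y → dist y ≤ suc (dist x)
    dist-arc {x} x→y = dist-minimal (inj₂ (x , dist-within x , x→y))

    dist≡0⇒≡b : ∀ {x} → dist x ≡ 0 → x ≡ b
    dist≡0⇒≡b {x} d≡0 = subst (λ m → Within m x) d≡0 (dist-within x)

    dist-parent : ∀ {x m} → dist x ≡ suc m → ∃ λ y → arc y x × dist y ≡ m
    dist-parent {x} {m} d≡1+m with subst (λ j → Within j x) d≡1+m (dist-within x)
    ... | inj₁ w            = contradiction (subst (_≤ m) d≡1+m (dist-minimal w)) 1+n≰n
    ... | inj₂ (y , w , y→x) =
      y , y→x ,
      ≤-antisym (dist-minimal w) (≤-pred (subst (_≤ suc (dist y)) d≡1+m (dist-arc y→x)))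

    record Geodesic (x : Fin n) (m : ℕ) : Set where
      field
        vertex      : ℕ → Fin n
        starts      : vertex 0 ≡ x
        ends        : vertex m ≡ b
        vertex-arc  : ∀ {j} → j < m → arc (vertex (suc j)) (vertex j)
        dist-vertex : ∀ {j} → j ≤ m → j + dist (vertex j) ≡ m

    extend : ∀ {x y m} → arc y x → dist x ≡ suc m → Geodesic y m → Geodesic x (suc m)
    extend {x} {y} {m} y→x dx≡1+m G = record
      { vertex = vertex′ ; starts = refl ; ends = ends
      ; vertex-arc = vertex-arc′ ; dist-vertex = dist-vertex′ }
      where
      open Geodesic G
      vertex′ : ℕ → Fin n
      vertex′ zero    = x
      vertex′ (suc j) = vertex j
      vertex-arc′ : ∀ {j} → j < suc m → arc (vertex′ (suc j)) (vertex′ j)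
      vertex-arc′ {zero}  _         = subst (λ z → arc z x) (sym starts) y→x
      vertex-arc′ {suc j} (s≤s j<m) = vertex-arc j<m
      dist-vertex′ : ∀ {j} → j ≤ suc m → j + dist (vertex′ j) ≡ suc m
      dist-vertex′ {zero}  _         = dx≡1+m
      dist-vertex′ {suc j} (s≤s j≤m) = cong suc (dist-vertex j≤m)

    geodesic : ∀ m {x} → dist x ≡ m → Geodesic x m
    geodesic zero {x} dx≡0 = record
      { vertex = λ _ → x ; starts = refl ; ends = dist≡0⇒≡b dx≡0
      ; vertex-arc = λ () ; dist-vertex = λ { z≤n → dx≡0 } }
    geodesic (suc m) dx≡1+m with dist-parent dx≡1+m
    ... | y , y→x , dy≡m = extend y→x dx≡1+m (geodesic m dy≡m)

  module Layers (SC : StronglyConnected T) {t} (AB : ArcBounded T t) (c₀ : Fin t) (b d : Fin n) where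
    open Distance SC b
    open ArcColouring AB c₀

    k : ℕ
    k = dist d

    open Geodesic (geodesic k refl)

    InLayer : ℕ → Pred (Fin n) 0ℓ
    InLayer j = N T (vertex (suc j)) (vertex j)

    b≢d⇒0<k : b ≢ d → 0 < k
    b≢d⇒0<k b≢d =
      n≢0⇒n>0 λ k≡0 → b≢d (trans (sym (subst (λ m → vertex m ≡ b) k≡0 ends)) starts)

    module _ (b≢d : b ≢ d) {v} (v⇒b : ReflClosure arc v b) (d⇒v : ReflClosure arc d v) where

      -- The vertex p₀ = d, or p₁ when v = d.
      unreached : ∃ λ a → a ≤ k × ¬ ReflClosure arc v (vertex a)
      unreached with v ≟ᶠ d
      ... | yes refl = 1 , 0<k , arc⇒¬reflClosure (subst (arc (vertex 1)) starts (vertex-arc 0<k))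
        where 0<k = b≢d⇒0<k b≢d
      ... | no  v≢d  =
        0 , z≤n , λ v⇒v₀ → v≢d (reflClosure-antisym (subst (ReflClosure arc v) starts v⇒v₀) d⇒v)

      layer : ∃ λ j → j < k × InLayer j v
      layer with unreached
      ... | a , a≤k , v⇏vₐ
          with crossing (reflClosure? v ∘ vertex) a≤k v⇏vₐ (subst (ReflClosure arc v) (sym ends) v⇒b)
      ... | j , j<k , v⇏vⱼ , v⇒vⱼ₊₁ = j , j<k , ¬reflClosure⇒arc v⇏vⱼ ,
                                      reflClosure⇒arc v⇒vⱼ₊₁ v⇏vⱼ (vertex-arc j<k)

    layer-window : ∀ {j w} → j < k → InLayer j w → k ≤ 2 + (j + dist w) × j + dist w ≤ 1 + k
    layer-window {j} {w} j<k (vⱼ→w , w→vⱼ₊₁) = lower , upper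
      where
      open ≤-Reasoning
      lower : k ≤ 2 + (j + dist w)
      lower = begin
        k                             ≡⟨ dist-vertex j<k ⟨
        suc j + dist (vertex (suc j)) ≤⟨ +-monoʳ-≤ (suc j) (dist-arc w→vⱼ₊₁) ⟩
        suc j + suc (dist w)          ≡⟨ cong suc (+-suc j (dist w)) ⟩
        2 + (j + dist w)              ∎
      upper : j + dist w ≤ 1 + k
      upper = begin
        j + dist w                    ≤⟨ +-monoʳ-≤ j (dist-arc vⱼ→w) ⟩
        j + suc (dist (vertex j))     ≡⟨ +-suc j _ ⟩
        suc (j + dist (vertex j))     ≡⟨ cong suc (dist-vertex (<⇒≤ j<k)) ⟩
        1 + k                         ∎

    layer-arc : ∀ {i j x y} → i < k → InLayer i x → j < k → InLayer j y → arc x y → i ≤ 4 + j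
    layer-arc {i} {j} {x} {y} i<k x∈i j<k y∈j x→y = +-cancelʳ-≤ (dist x) i (4 + j) (begin
      i + dist x           ≤⟨ proj₂ (layer-window i<k x∈i) ⟩
      1 + k                ≤⟨ s≤s (proj₁ (layer-window j<k y∈j)) ⟩
      3 + (j + dist y)     ≤⟨ +-monoʳ-≤ (3 + j) (dist-arc x→y) ⟩
      3 + (j + suc (dist x)) ≡⟨ cong (3 +_) (+-suc j (dist x)) ⟩
      4 + j + dist x       ∎)
      where open ≤-Reasoning

    layerColouring : ℕ → Fin n → Fin t
    layerColouring j = arcColouring (vertex (suc j)) (vertex j)

    LayerClass : Fin t → ℕ → Pred (Fin n) 0ℓ
    LayerClass c j w = InLayer j w × layerColouring j w ≡ c

    Placed : Fin t → ℕ → Pred (Fin n) 0ℓ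
    Placed c j w = j < k × LayerClass c j w

    -- By layer-arc, ι can only increase along an arc inside a residue class mod 5.
    placed-acyclic : (S : Pred (Fin n) 0ℓ) (ι : Fin n → ℕ) {r : ℕ} {c : Fin t} →
                     (∀ {w} → S w → Placed c (ι w) w) → (∀ {w} → S w → ι w % 5 ≡ r) →
                     Acyclic T S
    placed-acyclic S ι placed residue = Acyclic-byLevels level-acyclic
      where
      ι-mono : ∀ {x y} → S x → S y → arc x y → ι x ≤ ι y
      ι-mono sx sy x→y with placed sx | placed sy
      ... | ιx<k , x∈ιx , _ | ιy<k , y∈ιy , _ =
        %-≡⇒≤ 5 (trans (residue sx) (sym (residue sy)))
                (s≤s (layer-arc ιx<k x∈ιx ιy<k y∈ιy x→y))
      open Levels S ι ι-mono
      level-acyclic : ∀ {w} → S w → Acyclic T (Level (ι w))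
      level-acyclic {w} sw =
        Acyclic-mono (λ (sz , ιz≡ιw) → subst (λ j → LayerClass _ j _) ιz≡ιw (proj₂ (placed sz)))
                     (arcColouring-acyclic (vertex-arc (proj₁ (placed sw))) _)

  module Colouring (SC : StronglyConnected T) {t} (AB : ArcBounded T t) (c₀ : Fin t)
                   {γ⁺ γ⁻ : Subset n} (dom : Dominating T γ⁺) (abs : Absorbing T γ⁻) where
    module L (b d : Fin n) = Layers SC AB c₀ b d

    absorbed : ∀ v → ∃ λ b → b ∈ γ⁻ × ReflClosure arc v b
    absorbed v with v ∈? γ⁻
    ... | yes v∈γ⁻ = v , v∈γ⁻ , refl
    ... | no  v∉γ⁻ with abs v v∉γ⁻
    ...   | b , b∈γ⁻ , v→b = b , b∈γ⁻ , [ v→b ]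

    dominated : ∀ v → ∃ λ d → d ∈ γ⁺ × ReflClosure arc d v
    dominated v with v ∈? γ⁺
    ... | yes v∈γ⁺ = v , v∈γ⁺ , refl
    ... | no  v∉γ⁺ with dom v v∉γ⁺
    ...   | d , d∈γ⁺ , d→v = d , d∈γ⁺ , [ d→v ]

    absorber dominator : Fin n → Fin n
    absorber  v = proj₁ (absorbed v)
    dominator v = proj₁ (dominated v)

    to-absorber : ∀ v → ReflClosure arc v (absorber v)
    to-absorber v = proj₂ (proj₂ (absorbed v))

    from-dominator : ∀ v → ReflClosure arc (dominator v) v
    from-dominator v = proj₂ (proj₂ (dominated v))

    -- The layer is junk when absorber v ≡ dominator v; then v is that vertex.
    placement : ∀ v → ∃ λ j → absorber v ≢ dominator v →
                j < L.k (absorber v) (dominator v) × L.InLayer (absorber v) (dominator v) j v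
    placement v with absorber v ≟ᶠ dominator v
    ... | yes b≡d = 0 , λ b≢d → contradiction b≡d b≢d
    ... | no  b≢d with L.layer _ _ b≢d (to-absorber v) (from-dominator v)
    ...   | j , inLayer = j , λ _ → inLayer

    level : Fin n → ℕ
    level v = proj₁ (placement v)

    levelColour : Fin n → Fin t
    levelColour v = L.layerColouring (absorber v) (dominator v) (level v) v

    colour : Fin n → Fin (5 * t * ∣ γ⁻ ∣ * ∣ γ⁺ ∣)
    colour v = combine (combine (combine (level v mod 5) (levelColour v))
                                (position γ⁻ (proj₁ (proj₂ (absorbed v)))))
                       (position γ⁺ (proj₁ (proj₂ (dominated v))))

    SameClass : Fin n → Pred (Fin n) 0ℓ
    SameClass u w = absorber w ≡ absorber u × dominator w ≡ dominator u ×
                    level w % 5 ≡ level u % 5 × levelColour w ≡ levelColour u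

    colour≡⇒SameClass : ∀ {u w} → colour w ≡ colour u → SameClass u w
    colour≡⇒SameClass {u} {w} eq
      with combine-injective {m = 5 * t * ∣ γ⁻ ∣} _ _ _ _ eq
    ... | eq₁ , d-eq with combine-injective {m = 5 * t} _ _ _ _ eq₁
    ... | eq₂ , b-eq with combine-injective {m = 5} _ _ _ _ eq₂
    ... | r-eq , c-eq = position-injective γ⁻ _ _ b-eq , position-injective γ⁺ _ _ d-eq ,
                        mod≡⇒%≡ 5 (level w) (level u) r-eq , c-eq

    SameClass-acyclic : ∀ u → Acyclic T (SameClass u)
    SameClass-acyclic u = by-cases (absorber u ≟ᶠ dominator u)
      where
      by-cases : Dec (absorber u ≡ dominator u) → Acyclic T (SameClass u)
      by-cases (yes b≡d) x y sx sy x→y _ =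
        irrefl x (subst (arc x) (trans (collapse sy) (sym (collapse sx))) x→y)
        where
        collapse : ∀ {w} → SameClass u w → w ≡ absorber u
        collapse {w} (b-eq , d-eq , _) = trans (reflClosure-antisym (to-absorber w) b⇒w) b-eq
          where
          b⇒w : ReflClosure arc (absorber w) w
          b⇒w = subst (λ z → ReflClosure arc z w) (trans d-eq (trans (sym b≡d) (sym b-eq)))
                      (from-dominator w)
      by-cases (no b≢d) =
        L.placed-acyclic (absorber u) (dominator u) (SameClass u) level placed
                         (λ (_ , _ , r-eq , _) → r-eq)
        where
        placed : ∀ {w} → SameClass u w →
                 L.Placed (absorber u) (dominator u) (levelColour u) (level w) w
        placed {w} (b-eq , d-eq , _ , c-eq) =
          subst₂ (λ b d → L.Placed b d (levelColour u) (level w) w) b-eq d-eq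
            (let j<k , inLayer = proj₂ (placement w) λ b≡d → b≢d (trans (sym b-eq) (trans b≡d d-eq))
             in j<k , inLayer , c-eq)

    colour-acyclic : ∀ K → Acyclic T (λ w → Whole T w × colour w ≡ K)
    colour-acyclic K u v au@(_ , cu≡K) =
      Acyclic-mono (λ (_ , cw≡K) → colour≡⇒SameClass (trans cw≡K (sym cu≡K)))
                   (SameClass-acyclic u) u v au

lemma2p6 : (n t : ℕ) → 1 ≤ t → (T : Tournament n) →
           StronglyConnected T → ArcBounded T t →
           (γ⁺ γ⁻ : Subset n) → Dominating T γ⁺ → Absorbing T γ⁻ →
           DichromaticAtMost T (Whole T) (5 * t * ∣ γ⁻ ∣ * ∣ γ⁺ ∣)
lemma2p6 n (suc t) _ T SC AB γ⁺ γ⁻ dom abs = colour , colour-acyclic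
  where open Colouring T SC AB zero dom abs
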